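{- Let $G=(V,E)$ be a graph admitting an optimal order, with vertices $v_1,v_2,\dots,v_{|V|}$ listed in that order. Let $M_{G,i}=\{v_a,v_{a+1},\dots,v_b\}$ be the $i$-th monotonic set, corresponding to the monotonic segment $\delta(a),\dots,\delta(b)$, and let $X=\bigcup_{t=1}^{i-1}M_{G,t}$. Then $M_{G,i}$ induces a clique in $G$, and for every $u\in M_{G,i}$ the number of edges of $G$ joining $u$ to vertices of $X$ equals $\delta(a)$.
   Context: For a graph $G=(V,E)$ and $A\subseteq V$, let $I(A)$ be the set of edges with both endpoints in $A$, and $I(m)=\max_{A\subseteq V,|A|=m}|I(A)|$. A set $A$ with $|A|=m$ is optimal if $|I(A)|=I(m)$; an optimal order is a total order on $V$ each of whose initial segments is an optimal set. The $\delta$-sequence is $(\delta(1),\dots,\delta(|V|))$ with $\delta(1)=0$ and $\delta(m)=I(m)-I(m-1)$ for $m\ge 2$. A monotonic segment is a run of consecutive entries $\delta(a),\dots,\delta(b)$ with $\delta(a)<\delta(a+1)<\cdots<\delta(b)$ which is maximal (cannot be extended to the left or right keeping this property); this partitions the $\delta$-sequence into monotonic segments, numbered from left to right. The $i$-th monotonic set $M_{G,i}$ is the set of vertices $v_a,\dots,v_b$ whose positions in the optimal order correspond to the entries of the $i$-th monotonic segment. -}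

module Defs where

open import Data.Bool using (Bool; true; false; _∧_; if_then_else_)
open import Data.Nat using (ℕ; zero; suc; _+_; _∸_; _⊔_; _<ᵇ_; _≡ᵇ_; pred)
open import Data.Fin using (Fin; toℕ)
open import Data.Fin.Properties using () renaming (_≟_ to _≟ᶠ_)
open import Data.List using (List; []; _∷_; map; _++_; foldr; filterᵇ; allFin; length)
open import Data.Bool.ListAction using (any)
open import Data.Vec using (Vec; []; _∷_; lookup; tabulate)
open import Relation.Nullary.Decidable using (⌊_⌋)

-- A finite graph on vertex set Fin n, given by a Bool-valued adjacency relation.
-- (Simplicity -- symmetry and irreflexivity -- is imposed as hypotheses in the theorem.)
Graph : ℕ → Set
Graph n = Fin n → Fin n → Bool

Subset : ℕ → Set
Subset n = Vec Bool n

countᵇ : {A : Set} → (A → Bool) → List A → ℕ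
countᵇ p xs = length (filterᵇ p xs)

card : {n : ℕ} → Subset n → ℕ
card {n} A = countᵇ (λ v → lookup A v) (allFin n)

edgesIn : {n : ℕ} → Graph n → Subset n → ℕ
edgesIn {n} G A =
  foldr _+_ 0 (map (λ i → countᵇ (λ j → (toℕ i <ᵇ toℕ j) ∧ lookup A i ∧ lookup A j ∧ G i j) (allFin n)) (allFin n))

allSubsets : (n : ℕ) → List (Subset n)
allSubsets zero = [] ∷ []
allSubsets (suc n) = map (true ∷_) (allSubsets n) ++ map (false ∷_) (allSubsets n)

Imax : {n : ℕ} → Graph n → ℕ → ℕ
Imax {n} G m = foldr _⊔_ 0 (map (edgesIn G) (filterᵇ (λ A → card A ≡ᵇ m) (allSubsets n)))

-- δ-sequence, 1-indexed: δ(1) = 0, δ(m) = I(m) - I(m-1) for m ≥ 2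
δ : {n : ℕ} → Graph n → ℕ → ℕ
δ G (suc (suc m)) = Imax G (suc (suc m)) ∸ Imax G (suc m)
δ G _ = 0

-- An order on the vertices: σ k is the vertex at (0-indexed) position k, i.e. v_{k+1} = σ k.
-- Initial segment {v_1, …, v_m} as a subset.
initSeg : {n : ℕ} → (Fin n → Fin n) → ℕ → Subset n
initSeg {n} σ m = tabulate (λ v → any (λ k → (toℕ k <ᵇ m) ∧ ⌊ σ k ≟ᶠ v ⌋) (allFin n))

-- number of edges joining vertex u to the vertex set X = {v_1, …, v_{a-1}}
edgesToPrefix : {n : ℕ} → Graph n → (Fin n → Fin n) → Fin n → ℕ → ℕ
edgesToPrefix {n} G σ u a = countᵇ (λ j → (suc (toℕ j) <ᵇ a) ∧ G u (σ j)) (allFin n)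

-- Let d_q(m) be the number of neighbours of v_q among v_1, …, v_m.  Since each initial segment
-- is optimal, δ(q) = d_q(q-1): it is what v_q adds to the optimal set {v_1, …, v_(q-1)}.  Comparing
-- {v_1, …, v_m, v_q} with the optimal (m+1)-sets gives d_q(m) ≤ δ(m+1) for m < q.  As d_q grows by
-- at most one per step, for v_q in the run δ(a) < ⋯ < δ(b):
--   δ(a) + (q-a) ≤ δ(q) = d_q(q-1) ≤ d_q(a-1) + (q-a) ≤ δ(a) + (q-a).
-- So equality holds throughout: d_q(a-1) = δ(a), and each of v_a, …, v_(q-1) is a neighbour of v_q.
module Submission where

open import Defs
open import Algebra.Bundles using (CommutativeMonoid)
import Algebra.Properties.CommutativeMonoid.Sum as MonoidSum
open import Data.Bool using (Bool; true; false; T; T?; _∧_; _∨_; if_then_else_)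
open import Data.Bool.Properties using (∨-commutativeMonoid; ∧-zeroʳ)
open import Data.Fin using (Fin; toℕ; zero; suc; fromℕ<)
open import Data.Fin.Properties using (_≟_; toℕ-injective; toℕ-fromℕ<; toℕ<n)
open import Data.List using (_∷_; map; foldr; filterᵇ; allFin; tabulate)
open import Data.List.Membership.Propositional using (_∈_)
open import Data.List.Membership.Propositional.Properties using (∈-map⁺; ∈-++⁺ˡ; ∈-++⁺ʳ; ∈-filter⁺)
open import Data.List.Properties using (map-tabulate)
open import Data.List.Relation.Unary.Any using (here; there)
open import Data.Nat using (ℕ; zero; suc; _+_; _∸_; _⊔_; _≤_; _<_; _≥_; _<ᵇ_; _≡ᵇ_; z≤n; s≤s; s≤s⁻¹)
open import Data.Nat.Properties
  using ( ≤-refl; ≤-reflexive; ≤-trans; ≤-antisym; <⇒≤; ≤⇒≯; <⇒≱; <-cmp; <ᵇ⇒<; ≡⇒≡ᵇ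
        ; +-suc; +-assoc; +-identityʳ; +-mono-≤; +-monoˡ-≤; +-monoʳ-≤; +-cancelˡ-≤; +-cancelʳ-≤
        ; m≤n+m; m≤m⊔n; m≤n⊔m; m<1+n⇒m<n∨m≡n; m+n∸n≡m; m∸n+n≡m; m+n≤o⇒m≤o∸n
        ; +-0-commutativeMonoid; module ≤-Reasoning)
open import Data.Product using (_×_; _,_; proj₁; proj₂)
open import Data.Sum using (_⊎_; inj₁; inj₂)
open import Data.Vec using ([]; _∷_; lookup)
import Data.Vec as Vec
import Data.Vec.Functional as Vector
open import Data.Vec.Properties using (lookup∘tabulate)
open import Function using (_∘_; id)
open import Function.Definitions using (Injective)
open import Relation.Binary.Definitions using (tri<; tri≈; tri>)
open import Relation.Binary.PropositionalEquality
  using (_≡_; _≢_; refl; sym; trans; cong; cong₂; subst; _≗_; module ≡-Reasoning)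
open import Relation.Nullary.Decidable using (⌊_⌋; yes; no)
open import Relation.Nullary.Negation using (contradiction)

𝟙 : Bool → ℕ
𝟙 b = if b then 1 else 0

𝟙≤1 : ∀ b → 𝟙 b ≤ 1
𝟙≤1 true = ≤-refl
𝟙≤1 false = z≤n

1≤𝟙⇒true : ∀ {b} → 1 ≤ 𝟙 b → b ≡ true
1≤𝟙⇒true {true} _ = refl

𝟙-∧ : ∀ a b → 𝟙 (a ∧ b) ≡ (if a then 𝟙 b else 0)
𝟙-∧ true b = refl
𝟙-∧ false b = refl

<ᵇ-irrefl : ∀ x → (x <ᵇ x) ≡ false
<ᵇ-irrefl zero = refl
<ᵇ-irrefl (suc x) = <ᵇ-irrefl x

<ᵇ-∧-split : ∀ x y b → x ≢ y → 𝟙 ((x <ᵇ y) ∧ b) + 𝟙 ((y <ᵇ x) ∧ b) ≡ 𝟙 b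
<ᵇ-∧-split zero zero b x≢y = contradiction refl x≢y
<ᵇ-∧-split zero (suc y) b x≢y = +-identityʳ (𝟙 b)
<ᵇ-∧-split (suc x) zero b x≢y = refl
<ᵇ-∧-split (suc x) (suc y) b x≢y = <ᵇ-∧-split x y b (x≢y ∘ cong suc)

-- ⌊_⌋ does not compute through the map′ in the suc/suc clause of _≟_.
⌊suc≟suc⌋ : ∀ {n} (p k : Fin n) → ⌊ suc p ≟ suc k ⌋ ≡ ⌊ p ≟ k ⌋
⌊suc≟suc⌋ p k with p ≟ k
... | yes _ = refl
... | no _ = refl

-- Used for (ℕ, +) and for (Bool, ∨): membership in an initial segment is a disjunction over positions.
module _ {c ℓ} (M : CommutativeMonoid c ℓ) where
  open CommutativeMonoid M
    using (Carrier; _≈_; setoid; ∙-congˡ; ∙-congʳ; identityˡ; identityʳ; assoc; comm)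
    renaming (_∙_ to _+ᴹ_; ε to 0ᴹ; trans to ≈-trans; sym to ≈-sym)
  open MonoidSum M using (sum; sum-replicate-zero; sum-cong-≗)
  open import Relation.Binary.Reasoning.Setoid setoid

  sum-if-≟ : ∀ {n} (p : Fin n) (f : Fin n → Carrier) →
             sum (λ k → if ⌊ p ≟ k ⌋ then f k else 0ᴹ) ≈ f p
  sum-if-≟ {suc n} zero f = ≈-trans (∙-congˡ (sum-replicate-zero n)) (identityʳ (f zero))
  sum-if-≟ {suc n} (suc p) f = begin
    0ᴹ +ᴹ sum (λ k → if ⌊ suc p ≟ suc k ⌋ then f (suc k) else 0ᴹ)
      ≈⟨ identityˡ _ ⟩
    sum (λ k → if ⌊ suc p ≟ suc k ⌋ then f (suc k) else 0ᴹ)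
      ≡⟨ sum-cong-≗ (λ k → cong (if_then f (suc k) else 0ᴹ) (⌊suc≟suc⌋ p k)) ⟩
    sum (λ k → if ⌊ p ≟ k ⌋ then f (suc k) else 0ᴹ)
      ≈⟨ sum-if-≟ p (λ k → f (suc k)) ⟩
    f (suc p) ∎

  sum-if-<ᵇ-suc : ∀ {n} (p : Fin n) (f : Fin n → Carrier) →
                  sum (λ k → if toℕ k <ᵇ suc (toℕ p) then f k else 0ᴹ)
                    ≈ f p +ᴹ sum (λ k → if toℕ k <ᵇ toℕ p then f k else 0ᴹ)
  sum-if-<ᵇ-suc {suc n} zero f = ∙-congˡ (≈-sym (identityˡ _))
  sum-if-<ᵇ-suc {suc n} (suc p) f = begin
    f zero +ᴹ sum (λ k → if toℕ k <ᵇ suc (toℕ p) then f (suc k) else 0ᴹ)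
      ≈⟨ ∙-congˡ (sum-if-<ᵇ-suc p (λ k → f (suc k))) ⟩
    f zero +ᴹ (f (suc p) +ᴹ rest)
      ≈⟨ assoc _ _ _ ⟨
    (f zero +ᴹ f (suc p)) +ᴹ rest
      ≈⟨ ∙-congʳ (comm _ _) ⟩
    (f (suc p) +ᴹ f zero) +ᴹ rest
      ≈⟨ assoc _ _ _ ⟩
    f (suc p) +ᴹ (f zero +ᴹ rest) ∎
    where rest = sum (λ k → if toℕ k <ᵇ toℕ p then f (suc k) else 0ᴹ)

open MonoidSum +-0-commutativeMonoid using (sum-syntax; sum-cong-≗; ∑-distrib-+; sum-replicate-zero)
module ⋁ = MonoidSum ∨-commutativeMonoid

foldr-tabulate : ∀ {A B : Set} (f : A → B → B) (e : B) {n} (g : Fin n → A) →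
                 foldr f e (tabulate g) ≡ Vector.foldr f e g
foldr-tabulate f e {zero} g = refl
foldr-tabulate f e {suc n} g = cong (f (g zero)) (foldr-tabulate f e (g ∘ suc))

countᵇ-tabulate : ∀ {A : Set} {n} (p : A → Bool) (g : Fin n → A) →
                  countᵇ p (tabulate g) ≡ ∑[ i < n ] 𝟙 (p (g i))
countᵇ-tabulate {n = zero} p g = refl
countᵇ-tabulate {n = suc n} p g with p (g zero)
... | true = cong suc (countᵇ-tabulate p (g ∘ suc))
... | false = countᵇ-tabulate p (g ∘ suc)

∑-if : ∀ {n} a (f : Fin n → ℕ) → ∑[ i < n ] (if a then f i else 0) ≡ (if a then ∑[ i < n ] f i else 0)
∑-if true f = refl
∑-if {n} false f = sum-replicate-zero n

module _ {n : ℕ} where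

  sumOver : (Fin n → Bool) → (Fin n → ℕ) → ℕ
  sumOver A f = ∑[ v < n ] (if A v then f v else 0)

  syntax sumOver A (λ v → x) = ∑[ v ∈ A ] x

  insert : Fin n → (Fin n → Bool) → Fin n → Bool
  insert u A v = ⌊ u ≟ v ⌋ ∨ A v

  sumOver-congˡ : ∀ {A B : Fin n → Bool} (f : Fin n → ℕ) → A ≗ B → sumOver A f ≡ sumOver B f
  sumOver-congˡ f A≗B = sum-cong-≗ (λ v → cong (if_then f v else 0) (A≗B v))

  sumOver-congʳ : ∀ (A : Fin n → Bool) {f g : Fin n → ℕ} → (∀ v → A v ≡ true → f v ≡ g v) →
                  sumOver A f ≡ sumOver A g
  sumOver-congʳ A {f} {g} f≡g = sum-cong-≗ pointwise
    where
    pointwise : ∀ v → (if A v then f v else 0) ≡ (if A v then g v else 0)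
    pointwise v with A v in Av
    ... | true = f≡g v Av
    ... | false = refl

  sumOver-+ : ∀ (A : Fin n → Bool) (f g : Fin n → ℕ) →
              sumOver A (λ v → f v + g v) ≡ sumOver A f + sumOver A g
  sumOver-+ A f g =
    trans (sum-cong-≗ split) (∑-distrib-+ (λ v → if A v then f v else 0) (λ v → if A v then g v else 0))
    where
    split : ∀ v → (if A v then f v + g v else 0) ≡ (if A v then f v else 0) + (if A v then g v else 0)
    split v with A v
    ... | true = refl
    ... | false = refl

  sumOver-insert : ∀ (u : Fin n) (A : Fin n → Bool) (f : Fin n → ℕ) → A u ≡ false →
                   sumOver (insert u A) f ≡ f u + sumOver A f
  sumOver-insert u A f Au≡false = begin
    sumOver (insert u A) f
      ≡⟨ sum-cong-≗ split ⟩
    ∑[ v < n ] ((if ⌊ u ≟ v ⌋ then f v else 0) + (if A v then f v else 0))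
      ≡⟨ ∑-distrib-+ (λ v → if ⌊ u ≟ v ⌋ then f v else 0) (λ v → if A v then f v else 0) ⟩
    ∑[ v < n ] (if ⌊ u ≟ v ⌋ then f v else 0) + sumOver A f
      ≡⟨ cong (_+ sumOver A f) (sum-if-≟ +-0-commutativeMonoid u f) ⟩
    f u + sumOver A f ∎
    where
    open ≡-Reasoning
    split : ∀ v → (if insert u A v then f v else 0)
                    ≡ (if ⌊ u ≟ v ⌋ then f v else 0) + (if A v then f v else 0)
    split v with u ≟ v
    ... | yes refl rewrite Au≡false = sym (+-identityʳ (f u))
    ... | no _ = refl

size : ∀ {n} → (Fin n → Bool) → ℕ
size A = ∑[ v ∈ A ] 1

degree : ∀ {n} → Graph n → Fin n → (Fin n → Bool) → ℕ
degree G w A = ∑[ v ∈ A ] 𝟙 (G w v)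

edges : ∀ {n} → Graph n → (Fin n → Bool) → ℕ
edges G A = ∑[ i ∈ A ] ∑[ j ∈ A ] 𝟙 ((toℕ i <ᵇ toℕ j) ∧ G i j)

edges-cong : ∀ {n} (G : Graph n) {A B : Fin n → Bool} → A ≗ B → edges G A ≡ edges G B
edges-cong G {B = B} A≗B = trans (sumOver-congˡ _ A≗B) (sumOver-congʳ B (λ i _ → sumOver-congˡ _ A≗B))

module _ {n} {u : Fin n} {A : Fin n → Bool} (u∉A : A u ≡ false) where

  size-insert : size (insert u A) ≡ suc (size A)
  size-insert = sumOver-insert u A (λ _ → 1) u∉A

  degree-insert : (G : Graph n) (w : Fin n) → degree G w (insert u A) ≡ 𝟙 (G w u) + degree G w A
  degree-insert G w = sumOver-insert u A (λ v → 𝟙 (G w v)) u∉A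

  edges-insert : (G : Graph n) → (∀ x y → G x y ≡ G y x) →
                 edges G (insert u A) ≡ degree G u A + edges G A
  edges-insert G sym-G = begin
    ∑[ i ∈ B ] ∑[ j ∈ B ] e i j
      ≡⟨ sumOver-congʳ B (λ i _ → sumOver-insert u A (e i) u∉A) ⟩
    ∑[ i ∈ B ] (e i u + ∑[ j ∈ A ] e i j)
      ≡⟨ sumOver-insert u A _ u∉A ⟩
    (e u u + ∑[ j ∈ A ] e u j) + ∑[ i ∈ A ] (e i u + ∑[ j ∈ A ] e i j)
      ≡⟨ cong₂ _+_ (cong (λ b → 𝟙 (b ∧ G u u) + ∑[ j ∈ A ] e u j) (<ᵇ-irrefl (toℕ u))) (sumOver-+ A _ _) ⟩
    ∑[ v ∈ A ] e u v + (∑[ v ∈ A ] e v u + edges G A)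
      ≡⟨ +-assoc (∑[ v ∈ A ] e u v) (∑[ v ∈ A ] e v u) (edges G A) ⟨
    (∑[ v ∈ A ] e u v + ∑[ v ∈ A ] e v u) + edges G A
      ≡⟨ cong (_+ edges G A) (sumOver-+ A _ _) ⟨
    ∑[ v ∈ A ] (e u v + e v u) + edges G A
      ≡⟨ cong (_+ edges G A) (sumOver-congʳ A both-directions) ⟩
    degree G u A + edges G A ∎
    where
    open ≡-Reasoning
    B = insert u A
    e : Fin n → Fin n → ℕ
    e i j = 𝟙 ((toℕ i <ᵇ toℕ j) ∧ G i j)
    -- Since u ∉ A, a new edge {u, v} is counted once, as (u, v) or as (v, u) according to their order.
    both-directions : ∀ v → A v ≡ true → e u v + e v u ≡ 𝟙 (G u v)
    both-directions v v∈A rewrite sym-G v u = <ᵇ-∧-split (toℕ u) (toℕ v) (G u v) u≢v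
      where
      u≢v : toℕ u ≢ toℕ v
      u≢v u≡v with trans (sym u∉A) (trans (cong A (toℕ-injective u≡v)) v∈A)
      ... | ()

card≡size : ∀ {n} (V : Subset n) → card V ≡ size (lookup V)
card≡size V = countᵇ-tabulate (lookup V) id

edgesIn≡edges : ∀ {n} (G : Graph n) (V : Subset n) → edgesIn G V ≡ edges G (lookup V)
edgesIn≡edges {n} G V = begin
  edgesIn G V
    ≡⟨ cong (foldr _+_ 0) (map-tabulate id pairsFrom) ⟩
  foldr _+_ 0 (tabulate pairsFrom)
    ≡⟨ foldr-tabulate _+_ 0 pairsFrom ⟩
  ∑[ i < n ] pairsFrom i
    ≡⟨ sum-cong-≗ {n} (λ i → trans (countᵇ-tabulate {n = n} _ id) (sum-cong-≗ {n} (guard i))) ⟩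
  ∑[ i < n ] ∑[ j < n ] (if A i then (if A j then e i j else 0) else 0)
    ≡⟨ sum-cong-≗ {n} (λ i → ∑-if (A i) (λ j → if A j then e i j else 0)) ⟩
  edges G A ∎
  where
  open ≡-Reasoning
  A = lookup V
  e : Fin n → Fin n → ℕ
  e i j = 𝟙 ((toℕ i <ᵇ toℕ j) ∧ G i j)
  pairsFrom : Fin n → ℕ
  pairsFrom i = countᵇ (λ j → (toℕ i <ᵇ toℕ j) ∧ A i ∧ A j ∧ G i j) (allFin n)
  guard : ∀ i j → 𝟙 ((toℕ i <ᵇ toℕ j) ∧ A i ∧ A j ∧ G i j)
                  ≡ (if A i then (if A j then e i j else 0) else 0)
  guard i j with A i | A j
  ... | true | true = refl
  ... | true | false = cong 𝟙 (∧-zeroʳ (toℕ i <ᵇ toℕ j))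
  ... | false | _ = cong 𝟙 (∧-zeroʳ (toℕ i <ᵇ toℕ j))

∈⇒≤foldr-⊔ : ∀ {x : ℕ} {xs} → x ∈ xs → x ≤ foldr _⊔_ 0 xs
∈⇒≤foldr-⊔ (here refl) = m≤m⊔n _ _
∈⇒≤foldr-⊔ {xs = y ∷ _} (there x∈xs) = ≤-trans (∈⇒≤foldr-⊔ x∈xs) (m≤n⊔m y _)

∈-allSubsets : ∀ {n} (V : Subset n) → V ∈ allSubsets n
∈-allSubsets [] = here refl
∈-allSubsets (true ∷ V) = ∈-++⁺ˡ (∈-map⁺ (true ∷_) (∈-allSubsets V))
∈-allSubsets {suc n} (false ∷ V) =
  ∈-++⁺ʳ (map (true ∷_) (allSubsets n)) (∈-map⁺ (false ∷_) (∈-allSubsets V))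

edgesIn≤Imax : ∀ {n} (G : Graph n) (V : Subset n) → edgesIn G V ≤ Imax G (card V)
edgesIn≤Imax G V = ∈⇒≤foldr-⊔ (∈-map⁺ (edgesIn G) V∈size-class)
  where
  V∈size-class : V ∈ filterᵇ (λ X → card X ≡ᵇ card V) (allSubsets _)
  V∈size-class = ∈-filter⁺ (T? ∘ λ X → card X ≡ᵇ card V) (∈-allSubsets V) (≡⇒≡ᵇ (card V) (card V) refl)

lookup-initSeg : ∀ {n} (σ : Fin n → Fin n) m v →
                 lookup (initSeg σ m) v ≡ ⋁.sum (λ k → if toℕ k <ᵇ m then ⌊ σ k ≟ v ⌋ else false)
lookup-initSeg {n} σ m v = begin
  lookup (initSeg σ m) v
    ≡⟨ lookup∘tabulate _ v ⟩
  foldr _∨_ false (map earlier (allFin n))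
    ≡⟨ cong (foldr _∨_ false) (map-tabulate id earlier) ⟩
  foldr _∨_ false (tabulate earlier)
    ≡⟨ foldr-tabulate _∨_ false earlier ⟩
  ⋁.sum earlier
    ≡⟨ ⋁.sum-cong-≗ {n} (λ k → ∧≡if (toℕ k <ᵇ m)) ⟩
  ⋁.sum (λ k → if toℕ k <ᵇ m then ⌊ σ k ≟ v ⌋ else false) ∎
  where
  open ≡-Reasoning
  earlier : Fin n → Bool
  earlier k = (toℕ k <ᵇ m) ∧ ⌊ σ k ≟ v ⌋
  ∧≡if : ∀ a {b} → (a ∧ b) ≡ (if a then b else false)
  ∧≡if true = refl
  ∧≡if false = refl

edgesToPrefix-suc : ∀ {n} (G : Graph n) (σ : Fin n → Fin n) w m →
                    edgesToPrefix G σ w (suc m) ≡ ∑[ j < n ] (if toℕ j <ᵇ m then 𝟙 (G w (σ j)) else 0)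
edgesToPrefix-suc {n} G σ w m =
  trans (countᵇ-tabulate {n = n} _ id) (sum-cong-≗ {n} (λ j → 𝟙-∧ (toℕ j <ᵇ m) _))

position-induction : ∀ {n ℓ} (P : ℕ → Set ℓ) → P 0 → (∀ (i : Fin n) → P (toℕ i) → P (suc (toℕ i))) →
                     ∀ m → m ≤ n → P m
position-induction P P0 P-suc zero _ = P0
position-induction P P0 P-suc (suc m) m<n =
  subst (P ∘ suc) (toℕ-fromℕ< m<n)
        (P-suc (fromℕ< m<n) (subst P (sym (toℕ-fromℕ< m<n)) (position-induction P P0 P-suc m (<⇒≤ m<n))))

module Increments {n : ℕ} (d : ℕ → ℕ) (g : Fin n → Bool)
                  (d-suc : ∀ i → d (suc (toℕ i)) ≡ 𝟙 (g i) + d (toℕ i)) where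

  d-suc-fromℕ< : ∀ {k} (k<n : k < n) → d (suc k) ≡ 𝟙 (g (fromℕ< k<n)) + d k
  d-suc-fromℕ< k<n =
    subst (λ k → d (suc k) ≡ 𝟙 (g (fromℕ< k<n)) + d k) (toℕ-fromℕ< k<n) (d-suc (fromℕ< k<n))

  d-growth : ∀ m t → t + m ≤ n → d (t + m) ≤ t + d m
  d-growth m zero _ = ≤-refl
  d-growth m (suc t) t+m<n = begin
    d (suc (t + m))            ≡⟨ d-suc-fromℕ< t+m<n ⟩
    𝟙 (g _) + d (t + m)       ≤⟨ +-mono-≤ (𝟙≤1 _) (d-growth m t (<⇒≤ t+m<n)) ⟩
    suc (t + d m)             ∎
    where open ≤-Reasoning

  d-saturated-last : ∀ m t (t+m<n : t + m < n) → suc t + d m ≤ d (suc t + m) →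
                   g (fromℕ< t+m<n) ≡ true × t + d m ≤ d (t + m)
  d-saturated-last m t t+m<n tight =
    1≤𝟙⇒true (+-cancelʳ-≤ (t + d m) 1 _ last-step-counts) , s≤s⁻¹ earlier-tight
    where
    tight-at-last : suc (t + d m) ≤ 𝟙 (g (fromℕ< t+m<n)) + d (t + m)
    tight-at-last = subst (suc (t + d m) ≤_) (d-suc-fromℕ< t+m<n) tight
    last-step-counts : 1 + (t + d m) ≤ 𝟙 (g (fromℕ< t+m<n)) + (t + d m)
    last-step-counts = ≤-trans tight-at-last (+-monoʳ-≤ _ (d-growth m t (<⇒≤ t+m<n)))
    earlier-tight : suc (t + d m) ≤ suc (d (t + m))
    earlier-tight = ≤-trans tight-at-last (+-monoˡ-≤ _ (𝟙≤1 _))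

  d-saturated : ∀ m t → t + m ≤ n → t + d m ≤ d (t + m) →
                ∀ i → m ≤ toℕ i → toℕ i < t + m → g i ≡ true
  d-saturated m zero _ _ i m≤i i<m = contradiction i<m (≤⇒≯ m≤i)
  d-saturated m (suc t) t+m<n tight i m≤i i<1+t+m
    with d-saturated-last m t t+m<n tight | m<1+n⇒m<n∨m≡n i<1+t+m
  ... | _ , tight-below | inj₁ i<t+m = d-saturated m t (<⇒≤ t+m<n) tight-below i m≤i i<t+m
  ... | new , _ | inj₂ i≡t+m =
    subst (λ j → g j ≡ true) (toℕ-injective (trans (toℕ-fromℕ< t+m<n) (sym i≡t+m))) new

strictly-increasing-rise : ∀ (f : ℕ → ℕ) {a b} → (∀ m → a ≤ m → m < b → f m < f (suc m)) →
                 ∀ t → t + a ≤ b → t + f a ≤ f (t + a)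
strictly-increasing-rise f increasing zero _ = ≤-refl
strictly-increasing-rise f {a} increasing (suc t) t+a<b =
  ≤-trans (s≤s (strictly-increasing-rise f increasing t (<⇒≤ t+a<b)))
          (increasing (t + a) (m≤n+m a t) t+a<b)

module OptimalOrder {n : ℕ} (G : Graph n) (sym-G : ∀ u v → G u v ≡ G v u)
                    (σ : Fin n → Fin n) (σ-injective : Injective _≡_ _≡_ σ)
                    (optimal : ∀ m → m ≤ n → edgesIn G (initSeg σ m) ≡ Imax G m) where

  -- prefix m = {v_1, …, v_m}, and σ i = v_(i+1) sits at the 0-indexed position i.
  prefix : ℕ → Fin n → Bool
  prefix m = lookup (initSeg σ m)

  prefix-zero : ∀ v → prefix 0 v ≡ false
  prefix-zero v = trans (lookup-initSeg σ 0 v) (⋁.sum-replicate-zero n)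

  prefix-suc : ∀ i → prefix (suc (toℕ i)) ≗ insert (σ i) (prefix (toℕ i))
  prefix-suc i v = begin
    prefix (suc (toℕ i)) v
      ≡⟨ lookup-initSeg σ (suc (toℕ i)) v ⟩
    ⋁.sum (λ k → if toℕ k <ᵇ suc (toℕ i) then ⌊ σ k ≟ v ⌋ else false)
      ≡⟨ sum-if-<ᵇ-suc ∨-commutativeMonoid i _ ⟩
    ⌊ σ i ≟ v ⌋ ∨ ⋁.sum (λ k → if toℕ k <ᵇ toℕ i then ⌊ σ k ≟ v ⌋ else false)
      ≡⟨ cong (⌊ σ i ≟ v ⌋ ∨_) (lookup-initSeg σ (toℕ i) v) ⟨
    insert (σ i) (prefix (toℕ i)) v ∎
    where open ≡-Reasoning

  σ∉prefix : ∀ i m → m ≤ toℕ i → prefix m (σ i) ≡ false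
  σ∉prefix i m m≤i =
    trans (lookup-initSeg σ m (σ i)) (trans (⋁.sum-cong-≗ {n} not-before) (⋁.sum-replicate-zero n))
    where
    not-before : ∀ k → (if toℕ k <ᵇ m then ⌊ σ k ≟ σ i ⌋ else false) ≡ false
    not-before k with toℕ k <ᵇ m in k<m | σ k ≟ σ i
    ... | false | _ = refl
    ... | true | no _ = refl
    ... | true | yes σk≡σi =
      contradiction (subst (m ≤_) (cong toℕ (sym (σ-injective σk≡σi))) m≤i)
                    (<⇒≱ (<ᵇ⇒< _ _ (subst T (sym k<m) _)))

  sumOver-prefix-zero : ∀ f → ∑[ v ∈ prefix 0 ] f v ≡ 0
  sumOver-prefix-zero f = trans (sumOver-congˡ f prefix-zero) (sum-replicate-zero n)

  degree-prefix-zero : ∀ w → degree G w (prefix 0) ≡ 0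
  degree-prefix-zero w = sumOver-prefix-zero (λ v → 𝟙 (G w v))

  size-prefix : ∀ m → m ≤ n → size (prefix m) ≡ m
  size-prefix = position-induction (λ m → size (prefix m) ≡ m)
    (sumOver-prefix-zero (λ _ → 1))
    (λ i ih → trans (sumOver-congˡ (λ _ → 1) (prefix-suc i))
                    (trans (size-insert {A = prefix (toℕ i)} (σ∉prefix i (toℕ i) ≤-refl)) (cong suc ih)))

  degree-prefix-suc : ∀ w i →
                      degree G w (prefix (suc (toℕ i))) ≡ 𝟙 (G w (σ i)) + degree G w (prefix (toℕ i))
  degree-prefix-suc w i = trans (sumOver-congˡ _ (prefix-suc i)) (degree-insert (σ∉prefix i _ ≤-refl) G w)

  Imax≡edges : ∀ m → m ≤ n → Imax G m ≡ edges G (prefix m)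
  Imax≡edges m m≤n = trans (sym (optimal m m≤n)) (edgesIn≡edges G (initSeg σ m))

  Imax-suc : ∀ i → Imax G (suc (toℕ i)) ≡ degree G (σ i) (prefix (toℕ i)) + Imax G (toℕ i)
  Imax-suc i = begin
    Imax G (suc (toℕ i))
      ≡⟨ Imax≡edges _ (toℕ<n i) ⟩
    edges G (prefix (suc (toℕ i)))
      ≡⟨ edges-cong G (prefix-suc i) ⟩
    edges G (insert (σ i) (prefix (toℕ i)))
      ≡⟨ edges-insert (σ∉prefix i _ ≤-refl) G sym-G ⟩
    degree G (σ i) (prefix (toℕ i)) + edges G (prefix (toℕ i))
      ≡⟨ cong (degree G (σ i) (prefix (toℕ i)) +_) (Imax≡edges (toℕ i) (<⇒≤ (toℕ<n i))) ⟨
    degree G (σ i) (prefix (toℕ i)) + Imax G (toℕ i) ∎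
    where open ≡-Reasoning

  δ-suc≡degree : ∀ i → δ G (suc (toℕ i)) ≡ degree G (σ i) (prefix (toℕ i))
  δ-suc≡degree i with toℕ i | Imax-suc i
  ... | zero | _ = sym (degree-prefix-zero (σ i))
  ... | suc m | Imax-step =
    trans (cong (_∸ Imax G (suc m)) Imax-step) (m+n∸n≡m (degree G (σ i) (prefix (suc m))) (Imax G (suc m)))

  degree+Imax≤Imax-suc : ∀ q m → m ≤ toℕ q → degree G (σ q) (prefix m) + Imax G m ≤ Imax G (suc m)
  degree+Imax≤Imax-suc q m m≤q = begin
    degree G (σ q) (prefix m) + Imax G m
      ≡⟨ cong (degree G (σ q) (prefix m) +_) (Imax≡edges m m≤n) ⟩
    degree G (σ q) (prefix m) + edges G (prefix m)
      ≡⟨ edges-insert (σ∉prefix q m m≤q) G sym-G ⟨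
    edges G (insert (σ q) (prefix m))
      ≡⟨ trans (edgesIn≡edges G X) (edges-cong G (lookup∘tabulate _)) ⟨
    edgesIn G X
      ≤⟨ edgesIn≤Imax G X ⟩
    Imax G (card X)
      ≡⟨ cong (Imax G) |X|≡1+m ⟩
    Imax G (suc m) ∎
    where
    open ≤-Reasoning
    m≤n : m ≤ n
    m≤n = ≤-trans m≤q (<⇒≤ (toℕ<n q))
    X : Subset n
    X = Vec.tabulate (insert (σ q) (prefix m))
    |X|≡1+m : card X ≡ suc m
    |X|≡1+m = begin-equality
      card X                          ≡⟨ card≡size X ⟩
      size (lookup X)                 ≡⟨ sumOver-congˡ (λ _ → 1) (lookup∘tabulate (insert (σ q) (prefix m))) ⟩
      size (insert (σ q) (prefix m))  ≡⟨ size-insert {A = prefix m} (σ∉prefix q m m≤q) ⟩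
      suc (size (prefix m))           ≡⟨ cong suc (size-prefix m m≤n) ⟩
      suc m                           ∎

  degree≤δ : ∀ q m → m ≤ toℕ q → degree G (σ q) (prefix m) ≤ δ G (suc m)
  degree≤δ q zero _ = ≤-reflexive (degree-prefix-zero (σ q))
  degree≤δ q (suc m) m<q = m+n≤o⇒m≤o∸n _ (degree+Imax≤Imax-suc q (suc m) m<q)

  degree≡edgesToPrefix : ∀ w m → m ≤ n → degree G w (prefix m) ≡ edgesToPrefix G σ w (suc m)
  degree≡edgesToPrefix w =
    position-induction (λ m → degree G w (prefix m) ≡ edgesToPrefix G σ w (suc m))
    (trans (degree-prefix-zero w) (sym (trans (edgesToPrefix-suc G σ w 0) (sum-replicate-zero n))))
    (λ i ih → begin
      degree G w (prefix (suc (toℕ i)))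
        ≡⟨ degree-prefix-suc w i ⟩
      𝟙 (G w (σ i)) + degree G w (prefix (toℕ i))
        ≡⟨ cong (𝟙 (G w (σ i)) +_) (trans ih (edgesToPrefix-suc G σ w (toℕ i))) ⟩
      𝟙 (G w (σ i)) + ∑[ j < n ] (if toℕ j <ᵇ toℕ i then 𝟙 (G w (σ j)) else 0)
        ≡⟨ sum-if-<ᵇ-suc +-0-commutativeMonoid i _ ⟨
      ∑[ j < n ] (if toℕ j <ᵇ suc (toℕ i) then 𝟙 (G w (σ j)) else 0)
        ≡⟨ edgesToPrefix-suc G σ w (suc (toℕ i)) ⟨
      edgesToPrefix G σ w (suc (suc (toℕ i))) ∎)
    where open ≡-Reasoning

  rise⇒saturated : ∀ q a → a ≤ toℕ q → (toℕ q ∸ a) + δ G (suc a) ≤ δ G (suc (toℕ q)) →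
                   degree G (σ q) (prefix a) ≡ δ G (suc a)
                   × (∀ j → a ≤ toℕ j → toℕ j < toℕ q → G (σ q) (σ j) ≡ true)
  rise⇒saturated q a a≤q rise = d[a]≡δ , adjacent
    where
    d : ℕ → ℕ
    d m = degree G (σ q) (prefix m)
    open Increments d (λ i → G (σ q) (σ i)) (degree-prefix-suc (σ q))
    t = toℕ q ∸ a
    t+a≡q : t + a ≡ toℕ q
    t+a≡q = m∸n+n≡m a≤q
    t+a≤n : t + a ≤ n
    t+a≤n = subst (_≤ n) (sym t+a≡q) (<⇒≤ (toℕ<n q))
    d[a]≤δ : d a ≤ δ G (suc a)
    d[a]≤δ = degree≤δ q a a≤q
    t+δ≤d[t+a] : t + δ G (suc a) ≤ d (t + a)
    t+δ≤d[t+a] = subst (λ k → t + δ G (suc a) ≤ d k) (sym t+a≡q) (subst (_ ≤_) (δ-suc≡degree q) rise)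
    d[a]≡δ : d a ≡ δ G (suc a)
    d[a]≡δ = ≤-antisym d[a]≤δ (+-cancelˡ-≤ t _ _ (≤-trans t+δ≤d[t+a] (d-growth a t t+a≤n)))
    adjacent : ∀ j → a ≤ toℕ j → toℕ j < toℕ q → G (σ q) (σ j) ≡ true
    adjacent j a≤j j<q = d-saturated a t t+a≤n (≤-trans (+-monoʳ-≤ t d[a]≤δ) t+δ≤d[t+a]) j a≤j
                                     (subst (toℕ j <_) (sym t+a≡q) j<q)

theorem4 : (n : ℕ) (G : Graph n)
    → (∀ u v → G u v ≡ G v u)
    → (∀ v → G v v ≡ false)
    → (σ : Fin n → Fin n) → Injective _≡_ _≡_ σ
    → (∀ m → m ≤ n → edgesIn G (initSeg σ m) ≡ Imax G m)
    → (a b : ℕ) → 1 ≤ a → a ≤ b → b ≤ n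
    → (∀ m → a ≤ m → m < b → δ G m < δ G (suc m))
    → (a ≡ 1 ⊎ δ G (a ∸ 1) ≥ δ G a)
    → (b ≡ n ⊎ δ G b ≥ δ G (suc b))
    → (∀ (k l : Fin n) → a ≤ suc (toℕ k) → suc (toℕ k) ≤ b
         → a ≤ suc (toℕ l) → suc (toℕ l) ≤ b → k ≢ l → G (σ k) (σ l) ≡ true)
      × (∀ (k : Fin n) → a ≤ suc (toℕ k) → suc (toℕ k) ≤ b
         → edgesToPrefix G σ (σ k) a ≡ δ G a)
theorem4 n G sym-G _ σ σ-injective optimal (suc a) b (s≤s z≤n) a<b b≤n increasing _ _ =
  clique , prefix-neighbours
  where
  open OptimalOrder G sym-G σ σ-injective optimal

  rise : ∀ k → a ≤ toℕ k → suc (toℕ k) ≤ b → (toℕ k ∸ a) + δ G (suc a) ≤ δ G (suc (toℕ k))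
  rise k a≤k k<b =
    subst (λ m → toℕ k ∸ a + δ G (suc a) ≤ δ G m) t+1+a≡1+k
          (strictly-increasing-rise (δ G) increasing (toℕ k ∸ a) (subst (_≤ b) (sym t+1+a≡1+k) k<b))
    where
    t+1+a≡1+k : toℕ k ∸ a + suc a ≡ suc (toℕ k)
    t+1+a≡1+k = trans (+-suc (toℕ k ∸ a) a) (cong suc (m∸n+n≡m a≤k))

  prefix-neighbours : ∀ k → suc a ≤ suc (toℕ k) → suc (toℕ k) ≤ b →
                      edgesToPrefix G σ (σ k) (suc a) ≡ δ G (suc a)
  prefix-neighbours k (s≤s a≤k) k<b = trans (sym (degree≡edgesToPrefix (σ k) a (≤-trans (<⇒≤ a<b) b≤n)))
                                            (proj₁ (rise⇒saturated k a a≤k (rise k a≤k k<b)))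

  clique : ∀ k l → suc a ≤ suc (toℕ k) → suc (toℕ k) ≤ b → suc a ≤ suc (toℕ l) → suc (toℕ l) ≤ b →
           k ≢ l → G (σ k) (σ l) ≡ true
  clique k l (s≤s a≤k) k<b (s≤s a≤l) l<b k≢l with <-cmp (toℕ k) (toℕ l)
  ... | tri< k<l _ _ = trans (sym-G (σ k) (σ l)) (proj₂ (rise⇒saturated l a a≤l (rise l a≤l l<b)) k a≤k k<l)
  ... | tri≈ _ k≡l _ = contradiction (toℕ-injective k≡l) k≢l
  ... | tri> _ _ l<k = proj₂ (rise⇒saturated k a a≤k (rise k a≤k k<b)) l a≤l l<k
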